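{- Let $H=(V,E)$ be a connected hypergraph, $c$ a positive integer, and $\mathcal{T}\subset V$ a terminal set. A terminal partition $(A,\mathcal{T}\setminus A)$ is useful if and only if the $A$-minimal $(A,\mathcal{T}\setminus A)$-mincut $(X^*,V\setminus X^*)$ is connected (i.e. $H[X^*]$ is connected) and $|\partial X^*|\le c$.
   Context: A hypergraph $H=(V,E)$ has a finite vertex set and a finite multiset of nonempty hyperedges; it is connected if any two vertices are joined by a path (consecutive vertices sharing a hyperedge). $H[X]$ has vertex set $X$ and hyperedges $\{e\cap X: e\in E, e\cap X\ne\emptyset\}$. For $X\subseteq V$, $\partial X$ is the multiset of hyperedges meeting both $X$ and $V\setminus X$. For disjoint $A,B\subseteq V$, an $(A,B)$-cut is $(X,V\setminus X)$ with $A\subseteq X$, $B\subseteq V\setminus X$, of value $|\partial X|$; an $(A,B)$-mincut has minimum value $\mathrm{mincut}_H(A,B)$. The $A$-minimal $(A,B)$-mincut is the $(A,B)$-mincut $(X^*,V\setminus X^*)$ with $X^*\subseteq X$ for every $(A,B)$-mincut $(X,V\setminus X)$ (it exists and is unique). A terminal partition $(A,B)$ of $\mathcal{T}$ is useful if $\mathrm{mincut}_H(A,B)\le c$ and for every $(A,B)$-mincut $(X,V\setminus X)$, $H[X]$ is connected. -}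

module Defs where

open import Data.Nat using (ℕ; _≤_)
open import Data.Fin using (Fin)
open import Data.Fin.Subset using (Subset; _∈_; _⊆_; _∩_; ∁; _─_; ⊤; Nonempty)
open import Data.Fin.Subset.Properties using (nonempty?)
open import Data.List using (List; length; filter)
open import Data.List.Relation.Unary.All using (All)
open import Data.List.Membership.Propositional using () renaming (_∈_ to _∈ₗ_)
open import Data.Product using (_×_; Σ; ∃)
open import Relation.Nullary using (Dec; ¬_)
open import Relation.Nullary.Decidable using (_×-dec_)

-- A hypergraph on vertex set Fin n: a finite multiset (list) of hyperedges.
Hyperedges : ℕ → Set
Hyperedges n = List (Subset n)

Wellformed : ∀ {n} → Hyperedges n → Set
Wellformed E = All Nonempty E

-- Paths in the induced subhypergraph H[X]: consecutive vertices lie in X and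
-- share a hyperedge e of H (i.e. share the hyperedge e ∩ X of H[X]).
data Reach {n} (E : Hyperedges n) (X : Subset n) : Fin n → Fin n → Set where
  here : ∀ {u} → u ∈ X → Reach E X u u
  step : ∀ {u w v} (e : Subset n) → e ∈ₗ E → u ∈ e → w ∈ e → u ∈ X → w ∈ X →
         Reach E X w v → Reach E X u v

InducedConnected : ∀ {n} → Hyperedges n → Subset n → Set
InducedConnected E X = ∀ u v → u ∈ X → v ∈ X → Reach E X u v

Connected : ∀ {n} → Hyperedges n → Set
Connected E = InducedConnected E ⊤

Crosses : ∀ {n} → Subset n → Subset n → Set
Crosses X e = Nonempty (e ∩ X) × Nonempty (e ∩ ∁ X)

crosses? : ∀ {n} (X e : Subset n) → Dec (Crosses X e)
crosses? X e = nonempty? (e ∩ X) ×-dec nonempty? (e ∩ ∁ X)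

-- |∂X| (counted with multiplicity)
boundary : ∀ {n} → Hyperedges n → Subset n → ℕ
boundary E X = length (filter (crosses? X) E)

IsCut : ∀ {n} → Subset n → Subset n → Subset n → Set
IsCut A B X = A ⊆ X × B ⊆ ∁ X

IsMincut : ∀ {n} → Hyperedges n → Subset n → Subset n → Subset n → Set
IsMincut E A B X = IsCut A B X × (∀ Y → IsCut A B Y → boundary E X ≤ boundary E Y)

-- mincut_H(A,B) ≤ c  (the minimum value is attained by some mincut)
MincutAtMost : ∀ {n} → Hyperedges n → Subset n → Subset n → ℕ → Set
MincutAtMost E A B c = ∃ λ X → IsMincut E A B X × boundary E X ≤ c

IsAMinimalMincut : ∀ {n} → Hyperedges n → Subset n → Subset n → Subset n → Set
IsAMinimalMincut E A B X = IsMincut E A B X × (∀ Y → IsMincut E A B Y → X ⊆ Y)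

Useful : ∀ {n} → Hyperedges n → ℕ → Subset n → Subset n → Set
Useful E c T A =
  MincutAtMost E A (T ─ A) c ×
  (∀ X → IsMincut E A (T ─ A) X → InducedConnected E X)

TerminalPartition : ∀ {n} → Subset n → Subset n → Set
TerminalPartition T A = A ⊆ T × Nonempty A × Nonempty (T ─ A)

{-# OPTIONS --safe #-}
-- Any (A,B)-mincut contains the A-minimal one, so the forward
-- direction is immediate. Conversely, let X be an (A,B)-mincut. Since
-- H[X*] is connected and X* ⊆ X, all of A lies in one component C of H[X].
-- Every hyperedge crossing C also crosses X (a hyperedge meeting C and X ∖ C
-- would merge them), so C is an (A,B)-cut with ∂C ⊆ ∂X. If X ≠ C, a path in
-- the connected hypergraph H from X ∖ C to a terminal of B leaves X through a
-- hyperedge that crosses X but misses C, so |∂C| < |∂X|, contradicting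
-- minimality. Hence X = C and H[X] is connected.
module Submission where

open import Defs
open import Data.Nat using (ℕ; zero; suc; _≤_; _<_; _+_; s≤s; z≤n)
open import Data.Nat.Properties
  using (m≤n⇒m≤1+n; <⇒≱; ≤-trans; ≤-reflexive; +-suc; +-monoˡ-≤; +-identityʳ; m≤n+m)
open import Data.Fin using (Fin)
open import Data.Fin.Subset using (Subset; Nonempty; _─_; _∈_; _∉_; _⊆_; _⊂_; _∩_; _∪_; ∁; ⁅_⁆; ∣_∣; ⊤)
open import Data.Fin.Subset.Properties
  using (_∈?_; x∈p∩q⁺; x∈p∩q⁻; x∈p∪q⁻; p⊆p∪q; q⊆p∪q; x∈⁅x⁆; x∈⁅y⁆⇒x≡y;
         x∉p⇒x∈∁p; x∈∁p⇒x∉p; ∣p∣≤n; p⊂q⇒∣p∣<∣q∣; ∈⊤)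
open import Data.Fin.Properties using (any?)
open import Data.List using (_∷_; length; filter)
open import Data.List.Relation.Unary.Any using (here; there)
  renaming (any? to anyₗ?)
open import Data.List.Relation.Unary.All using (All; []; _∷_; tabulate)
open import Data.List.Membership.Propositional using (find; lose) renaming (_∈_ to _∈ₗ_)
open import Data.Product using (Σ-syntax; ∃₂; _×_; _,_; proj₁; proj₂)
open import Data.Sum using (inj₁; inj₂)
open import Function using (id; _∘_)
open import Function.Bundles using (_⇔_; mk⇔)
open import Relation.Nullary using (Dec; yes; no; ¬_; ¬?; contradiction)
open import Relation.Nullary.Decidable using (_×-dec_)
open import Relation.Unary using (Decidable)
open import Relation.Binary.PropositionalEquality using (refl)

module _ {A : Set} {P Q : A → Set} (P? : Decidable P) (Q? : Decidable Q) where

  length-filter-mono : ∀ {xs} → All (λ x → P x → Q x) xs →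
                       length (filter P? xs) ≤ length (filter Q? xs)
  length-filter-mono [] = z≤n
  length-filter-mono {x ∷ _} (P⇒Q ∷ P⇒Qs) with P? x | Q? x
  ... | yes _  | yes _  = s≤s (length-filter-mono P⇒Qs)
  ... | yes px | no ¬qx = contradiction (P⇒Q px) ¬qx
  ... | no _   | yes _  = m≤n⇒m≤1+n (length-filter-mono P⇒Qs)
  ... | no _   | no _   = length-filter-mono P⇒Qs

  length-filter-strict : ∀ {xs} → All (λ x → P x → Q x) xs →
                         ∀ {y} → y ∈ₗ xs → Q y → ¬ P y →
                         length (filter P? xs) < length (filter Q? xs)
  length-filter-strict {x ∷ _} (_ ∷ P⇒Qs) (here refl) qy ¬py with P? x | Q? x
  ... | yes py | _      = contradiction py ¬py
  ... | no _   | no ¬qy = contradiction qy ¬qy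
  ... | no _   | yes _  = s≤s (length-filter-mono P⇒Qs)
  length-filter-strict {x ∷ _} (P⇒Q ∷ P⇒Qs) (there y∈xs) qy ¬py with P? x | Q? x
  ... | yes _  | yes _  = s≤s (length-filter-strict P⇒Qs y∈xs qy ¬py)
  ... | yes px | no ¬qx = contradiction (P⇒Q px) ¬qx
  ... | no _   | yes _  = m≤n⇒m≤1+n (length-filter-strict P⇒Qs y∈xs qy ¬py)
  ... | no _   | no _   = length-filter-strict P⇒Qs y∈xs qy ¬py

module _ {n} {E : Hyperedges n} where

  Reach-mono : ∀ {X Y u v} → X ⊆ Y → Reach E X u v → Reach E Y u v
  Reach-mono X⊆Y (here u∈X) = here (X⊆Y u∈X)
  Reach-mono X⊆Y (step e e∈E u∈e w∈e u∈X w∈X w↝v) =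
    step e e∈E u∈e w∈e (X⊆Y u∈X) (X⊆Y w∈X) (Reach-mono X⊆Y w↝v)

module ReachIn {n} (E : Hyperedges n) (X : Subset n) where

  Adjacent : Fin n → Fin n → Set
  Adjacent u v = Σ[ e ∈ Subset n ] e ∈ₗ E × u ∈ e × v ∈ e × u ∈ X × v ∈ X

  adjacent? : ∀ u v → Dec (Adjacent u v)
  adjacent? u v with anyₗ? (λ e → (u ∈? e) ×-dec (v ∈? e)) E | u ∈? X | v ∈? X
  ... | yes ∃e | yes u∈X | yes v∈X with find ∃e
  ...   | e , e∈E , u∈e , v∈e = yes (e , e∈E , u∈e , v∈e , u∈X , v∈X)
  adjacent? u v | no ∄e | _ | _ = no λ (_ , e∈E , u∈e , v∈e , _) → ∄e (lose e∈E (u∈e , v∈e))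
  adjacent? u v | _ | no u∉X | _ = no λ (_ , _ , _ , _ , u∈X , _) → u∉X u∈X
  adjacent? u v | _ | _ | no v∉X = no λ (_ , _ , _ , _ , _ , v∈X) → v∉X v∈X

  Reach-end : ∀ {u v} → Reach E X u v → v ∈ X
  Reach-end (here v∈X) = v∈X
  Reach-end (step _ _ _ _ _ _ w↝v) = Reach-end w↝v

  Reach-trans : ∀ {u v w} → Reach E X u v → Reach E X v w → Reach E X u w
  Reach-trans (here _) v↝w = v↝w
  Reach-trans (step e e∈E u∈e x∈e u∈X x∈X x↝v) v↝w = step e e∈E u∈e x∈e u∈X x∈X (Reach-trans x↝v v↝w)

  Reach-adjacent : ∀ {u v} → Adjacent u v → Reach E X u v
  Reach-adjacent (e , e∈E , u∈e , v∈e , u∈X , v∈X) = step e e∈E u∈e v∈e u∈X v∈X (here v∈X)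

  Reach-sym : ∀ {u v} → Reach E X u v → Reach E X v u
  Reach-sym (here u∈X) = here u∈X
  Reach-sym (step e e∈E u∈e w∈e u∈X w∈X w↝v) =
    Reach-trans (Reach-sym w↝v) (Reach-adjacent (e , e∈E , w∈e , u∈e , w∈X , u∈X))

  Closed : Subset n → Set
  Closed C = ∀ {u v} → u ∈ C → Adjacent u v → v ∈ C

  Reach-closed : ∀ {C} → Closed C → ∀ {u v} → u ∈ C → Reach E X u v → v ∈ C
  Reach-closed C-closed u∈C (here _) = u∈C
  Reach-closed C-closed u∈C (step e e∈E u∈e w∈e u∈X w∈X w↝v) =
    Reach-closed C-closed (C-closed u∈C (e , e∈E , u∈e , w∈e , u∈X , w∈X)) w↝v

  Exit : Subset n → Set
  Exit S = ∃₂ λ u v → u ∈ S × v ∉ S × Adjacent u v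

  exit? : ∀ S → Dec (Exit S)
  exit? S = any? λ u → any? λ v → (u ∈? S) ×-dec (¬? (v ∈? S) ×-dec adjacent? u v)

  ¬Exit⇒Closed : ∀ {S} → ¬ Exit S → Closed S
  ¬Exit⇒Closed {S} ¬exit {u} {v} u∈S u~v with v ∈? S
  ... | yes v∈S = v∈S
  ... | no v∉S = contradiction (u , v , u∈S , v∉S , u~v) ¬exit

  ReachableFrom : Fin n → Subset n → Set
  ReachableFrom u S = ∀ {v} → v ∈ S → Reach E X u v

  ClosedReachableSuperset : Fin n → Subset n → Set
  ClosedReachableSuperset u S = Σ[ C ∈ Subset n ] S ⊆ C × ReachableFrom u C × Closed C

  ⊂-∪-exit : ∀ {u S v} → ReachableFrom u S → (Σ[ w ∈ Fin n ] w ∈ S × v ∉ S × Adjacent w v) →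
             S ⊂ S ∪ ⁅ v ⁆ × ReachableFrom u (S ∪ ⁅ v ⁆)
  ⊂-∪-exit {u} {S} {v} u↝S (w , w∈S , v∉S , w~v) =
    (p⊆p∪q ⁅ v ⁆ , v , q⊆p∪q S ⁅ v ⁆ (x∈⁅x⁆ v) , v∉S) , u↝S∪v
    where
    u↝S∪v : ReachableFrom u (S ∪ ⁅ v ⁆)
    u↝S∪v {x} x∈S∪v with x∈p∪q⁻ S ⁅ v ⁆ x∈S∪v
    ... | inj₁ x∈S = u↝S x∈S
    ... | inj₂ x∈v rewrite x∈⁅y⁆⇒x≡y v x∈v = Reach-trans (u↝S w∈S) (Reach-adjacent w~v)

  -- k is fuel: each added exit vertex enlarges S, which n ≤ ∣ S ∣ + k allows at most k more times.
  closedReachableSuperset : ∀ {u} k S → n ≤ ∣ S ∣ + k → ReachableFrom u S → ClosedReachableSuperset u S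
  closedReachableSuperset k S _ u↝S with exit? S
  ... | no ¬exit = S , id , u↝S , ¬Exit⇒Closed ¬exit
  ... | yes (w , v , exit) with ⊂-∪-exit u↝S (w , exit)
  closedReachableSuperset zero S n≤∣S∣+0 _ | yes (_ , v , _) | S⊂S′ , _ =
    contradiction (≤-trans (∣p∣≤n (S ∪ ⁅ v ⁆)) (≤-trans n≤∣S∣+0 (≤-reflexive (+-identityʳ ∣ S ∣))))
                  (<⇒≱ (p⊂q⇒∣p∣<∣q∣ S⊂S′))
  closedReachableSuperset (suc k) S n≤∣S∣+1+k _ | yes (_ , v , _) | S⊂S′ , u↝S′
    with closedReachableSuperset k (S ∪ ⁅ v ⁆) n≤∣S′∣+k u↝S′
    where
    n≤∣S′∣+k : n ≤ ∣ S ∪ ⁅ v ⁆ ∣ + k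
    n≤∣S′∣+k = ≤-trans n≤∣S∣+1+k (≤-trans (≤-reflexive (+-suc ∣ S ∣ k)) (+-monoˡ-≤ k (p⊂q⇒∣p∣<∣q∣ S⊂S′)))
  ... | C , S′⊆C , u↝C , C-closed = C , (λ x∈S → S′⊆C (proj₁ S⊂S′ x∈S)) , u↝C , C-closed

  component : ∀ {u} → u ∈ X → Σ[ C ∈ Subset n ] u ∈ C × ReachableFrom u C × Closed C
  component {u} u∈X with closedReachableSuperset n ⁅ u ⁆ (m≤n+m n ∣ ⁅ u ⁆ ∣) u↝u
    where
    u↝u : ReachableFrom u ⁅ u ⁆
    u↝u v∈u rewrite x∈⁅y⁆⇒x≡y u v∈u = here u∈X
  ... | C , u⊆C , u↝C , C-closed = C , u⊆C (x∈⁅x⁆ u) , u↝C , C-closed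

crosses : ∀ {n} {S e : Subset n} {u w} → u ∈ e → u ∈ S → w ∈ e → w ∉ S → Crosses S e
crosses u∈e u∈S w∈e w∉S = (_ , x∈p∩q⁺ (u∈e , u∈S)) , (_ , x∈p∩q⁺ (w∈e , x∉p⇒x∈∁p w∉S))

module ClosedBoundary {n} (E : Hyperedges n) {X C : Subset n} (C⊆X : C ⊆ X)
                      (C-closed : ReachIn.Closed E X C) where

  meets-closed⇒⊆ : ∀ {e u} → e ∈ₗ E → u ∈ e → u ∈ X → Nonempty (e ∩ C) → u ∈ C
  meets-closed⇒⊆ {e} e∈E u∈e u∈X (x , x∈e∩C) with x∈p∩q⁻ e C x∈e∩C
  ... | x∈e , x∈C = C-closed x∈C (e , e∈E , x∈e , u∈e , C⊆X x∈C , u∈X)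

  crosses-closed⇒crosses : ∀ {e} → e ∈ₗ E → Crosses C e → Crosses X e
  crosses-closed⇒crosses {e} e∈E (meets-C@(x , x∈e∩C) , w , w∈e∩∁C)
    with x∈p∩q⁻ e C x∈e∩C | x∈p∩q⁻ e (∁ C) w∈e∩∁C
  ... | x∈e , x∈C | w∈e , w∈∁C with w ∈? X
  ...   | yes w∈X = contradiction (meets-closed⇒⊆ e∈E w∈e w∈X meets-C) (x∈∁p⇒x∉p w∈∁C)
  ...   | no w∉X = crosses x∈e (C⊆X x∈C) w∈e w∉X

  leaving-edge : ∀ {u t} → Reach E ⊤ u t → u ∈ X → u ∉ C → t ∉ X →
                 Σ[ e ∈ Subset n ] e ∈ₗ E × Crosses X e × ¬ Crosses C e
  leaving-edge (here _) u∈X _ t∉X = contradiction u∈X t∉X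
  leaving-edge (step {w = w} e e∈E u∈e w∈e _ _ w↝t) u∈X u∉C t∉X with w ∈? X
  ... | no w∉X = e , e∈E , crosses u∈e u∈X w∈e w∉X ,
                 λ (meets-C , _) → u∉C (meets-closed⇒⊆ e∈E u∈e u∈X meets-C)
  ... | yes w∈X = leaving-edge w↝t w∈X w∉C t∉X
    where
    w∉C : w ∉ C
    w∉C w∈C = u∉C (C-closed w∈C (e , e∈E , w∈e , u∈e , w∈X , u∈X))

  boundary-closed-< : Connected E → ∀ {v t} → v ∈ X → v ∉ C → t ∉ X → boundary E C < boundary E X
  boundary-closed-< E-connected v∈X v∉C t∉X with leaving-edge (E-connected _ _ ∈⊤ ∈⊤) v∈X v∉C t∉X
  ... | e , e∈E , e-crosses-X , ¬e-crosses-C =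
    length-filter-strict (crosses? C) (crosses? X) (tabulate crosses-closed⇒crosses)
      e∈E e-crosses-X ¬e-crosses-C

module _ {n} {E : Hyperedges n} {A B X : Subset n} (E-connected : Connected E)
         (B-nonempty : Nonempty B) (X-mincut : IsMincut E A B X) where

  open ReachIn E X

  mincut-⊆-closed : ∀ {C} → C ⊆ X → Closed C → A ⊆ C → X ⊆ C
  mincut-⊆-closed {C} C⊆X C-closed A⊆C {v} v∈X with v ∈? C
  ... | yes v∈C = v∈C
  ... | no v∉C = contradiction (proj₂ X-mincut C C-cut) (<⇒≱ ∂C<∂X)
    where
    B⊆∁X : B ⊆ ∁ X
    B⊆∁X = proj₂ (proj₁ X-mincut)
    C-cut : IsCut A B C
    C-cut = A⊆C , λ x∈B → x∉p⇒x∈∁p λ x∈C → x∈∁p⇒x∉p (B⊆∁X x∈B) (C⊆X x∈C)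
    ∂C<∂X : boundary E C < boundary E X
    ∂C<∂X = ClosedBoundary.boundary-closed-< E C⊆X C-closed E-connected v∈X v∉C
              (x∈∁p⇒x∉p (B⊆∁X (proj₂ B-nonempty)))

  mincut-connected : ∀ {a} → a ∈ A → (∀ {x} → x ∈ A → Reach E X a x) → InducedConnected E X
  mincut-connected {a} a∈A a↝A u v u∈X v∈X with component (proj₁ (proj₁ X-mincut) a∈A)
  ... | C , a∈C , a↝C , C-closed = Reach-trans (Reach-sym (a↝C (X⊆C u∈X))) (a↝C (X⊆C v∈X))
    where
    X⊆C : X ⊆ C
    X⊆C = mincut-⊆-closed (Reach-end ∘ a↝C) C-closed (Reach-closed C-closed a∈C ∘ a↝A)

lemma23 : ∀ {n} (E : Hyperedges n) → Wellformed E → Connected E →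
    (c : ℕ) → 1 ≤ c → (T A : Subset n) → TerminalPartition T A →
    (X* : Subset n) → IsAMinimalMincut E A (T ─ A) X* →
    Useful E c T A ⇔ (InducedConnected E X* × boundary E X* ≤ c)
lemma23 E _ E-connected c _ T A (_ , (_ , a∈A) , B-nonempty) X* (X*-mincut , X*-minimal) =
  mk⇔ to from
  where
  to : Useful E c T A → InducedConnected E X* × boundary E X* ≤ c
  to ((Y , (Y-cut , _) , ∂Y≤c) , mincuts-connected) =
    mincuts-connected X* X*-mincut , ≤-trans (proj₂ X*-mincut Y Y-cut) ∂Y≤c

  from : InducedConnected E X* × boundary E X* ≤ c → Useful E c T A
  from (X*-connected , ∂X*≤c) = (X* , X*-mincut , ∂X*≤c) , X-connected
    where
    A⊆X* : A ⊆ X*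
    A⊆X* = proj₁ (proj₁ X*-mincut)
    X-connected : ∀ X → IsMincut E A (T ─ A) X → InducedConnected E X
    X-connected X X-mincut = mincut-connected E-connected B-nonempty X-mincut a∈A
      λ x∈A → Reach-mono (X*-minimal X X-mincut) (X*-connected _ _ (A⊆X* a∈A) (A⊆X* x∈A))
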